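{- The following two statements are equivalent: (1) for all weighted graphs $G$ and $H$, all positive integers $s$ and $t$, and all vertices $x \in V(G)$, $y \in V(H)$, we have $\pi_{st}(G \times H, (x, y)) \leq \pi_s(G, x)\, \pi_t(H, y)$; (2) for all weighted graphs $G$ and $H$ and all vertices $x \in V(G)$, $y \in V(H)$, we have $\pi(G \times H, (x, y)) \leq \pi(G, x)\, \pi(H, y)$.
   Context: A weighted graph is a finite undirected graph $G$ with a function $w: E(G) \to \mathbb{N}^+$. A distribution is a function from the vertex set to $\mathbb{N}$ (numbers of pebbles). A pebbling move along an edge $e = xx'$ removes $w(e)$ pebbles from $x$ and places one pebble on $x'$. For a vertex $v$ and positive integer $t$, $\pi_t(G,v)$ is the smallest number $N$ such that from every distribution with at least $N$ pebbles, a sequence of pebbling moves yields a distribution with at least $t$ pebbles on $v$ ($\infty$ if no such $N$ exists); $\pi(G,v)=\pi_1(G,v)$. The Cartesian product of weighted graphs $G\times H$ has vertex set $V(G)\times V(H)$, edges $(x,y)(x,y')$ for $yy'\in E(H)$ with weight $w(yy')$ and $(x,y)(x',y)$ for $xx'\in E(G)$ with weight $w(xx')$. -}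

module Defs where

open import Data.Nat using (ℕ; zero; suc; _+_; _*_; _∸_; _≤_; _<_)
open import Data.Fin using (Fin; remQuot; combine)
import Data.Fin as Fin
open import Data.Bool using (Bool; true; false; if_then_else_)
open import Data.Product using (Σ; ∃; _×_; _,_; proj₁; proj₂)
open import Relation.Nullary using (does; yes; no)
open import Data.Empty using (⊥-elim)
import Relation.Binary.PropositionalEquality as ≡
open import Relation.Binary.PropositionalEquality using (_≡_; refl)
open import Relation.Binary.Construct.Closure.ReflexiveTransitive using (Star)

-- A finite weighted (simple, undirected) graph on the vertex set Fin size.
-- weight i j = 0 means "no edge between i and j"; a positive value is the
-- weight w(ij) ∈ ℕ⁺ of the edge ij.
record WGraph : Set where
  field
    size   : ℕ
    weight : Fin size → Fin size → ℕ
    sym    : ∀ i j → weight i j ≡ weight j i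
    loopless : ∀ i → weight i i ≡ 0
open WGraph public

Vertex : WGraph → Set
Vertex G = Fin (size G)

_==_ : ∀ {n} → Fin n → Fin n → Bool
i == j = does (i Fin.≟ j)

prodW : (G H : WGraph) → Vertex G → Vertex H → Vertex G → Vertex H → ℕ
prodW G H x y x' y' with x Fin.≟ x' | y Fin.≟ y'
... | yes _ | _     = weight H y y'
... | no _  | yes _ = weight G x x'
... | no _  | no _  = 0

prodW-sym : (G H : WGraph) (x : Vertex G) (y : Vertex H) (x' : Vertex G) (y' : Vertex H) →
            prodW G H x y x' y' ≡ prodW G H x' y' x y
prodW-sym G H x y x' y' with x Fin.≟ x' | y Fin.≟ y' | x' Fin.≟ x | y' Fin.≟ y
... | yes _ | _     | yes _ | _     = WGraph.sym H y y'
... | yes p | _     | no q  | _     = ⊥-elim (q (≡.sym p))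
... | no p  | _     | yes q | _     = ⊥-elim (p (≡.sym q))
... | no _  | yes _ | no _  | yes _ = WGraph.sym G x x'
... | no _  | yes p | no _  | no q  = ⊥-elim (q (≡.sym p))
... | no _  | no p  | no _  | yes q = ⊥-elim (p (≡.sym q))
... | no _  | no _  | no _  | no _  = refl

prodW-loop : (G H : WGraph) (x : Vertex G) (y : Vertex H) → prodW G H x y x y ≡ 0
prodW-loop G H x y with x Fin.≟ x
... | yes _ = loopless H y
... | no p  = ⊥-elim (p refl)

-- Cartesian product G × H; vertex (x , y) is encoded as combine x y ∈ Fin (|G|·|H|)
-- (remQuot is its inverse).
_⊠_ : WGraph → WGraph → WGraph
G ⊠ H = record
  { size = size G * size H
  ; weight = λ u v → prodW G H (proj₁ (rq u)) (proj₂ (rq u)) (proj₁ (rq v)) (proj₂ (rq v))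
  ; sym = λ u v → prodW-sym G H (proj₁ (rq u)) (proj₂ (rq u)) (proj₁ (rq v)) (proj₂ (rq v))
  ; loopless = λ u → prodW-loop G H (proj₁ (rq u)) (proj₂ (rq u))
  }
  where
  rq : Fin (size G * size H) → Fin (size G) × Fin (size H)
  rq = remQuot {size G} (size H)

pair : (G H : WGraph) → Vertex G → Vertex H → Vertex (G ⊠ H)
pair G H x y = combine x y

Distribution : WGraph → Set
Distribution G = Vertex G → ℕ

total : ∀ {n} → (Fin n → ℕ) → ℕ
total {zero}  d = 0
total {suc n} d = d Fin.zero + total (λ i → d (Fin.suc i))

moveResult : (G : WGraph) → Vertex G → Vertex G → Distribution G → Distribution G
moveResult G i j d v =
  if v == i then d v ∸ weight G i j
  else (if v == j then suc (d v) else d v)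

data Step (G : WGraph) : Distribution G → Distribution G → Set where
  move : ∀ (d : Distribution G) (i j : Vertex G) →
         0 < weight G i j → weight G i j ≤ d i →
         Step G d (moveResult G i j d)

Reach : (G : WGraph) → Distribution G → Distribution G → Set
Reach G = Star (Step G)

Solvable : (G : WGraph) → Vertex G → ℕ → ℕ → Set
Solvable G v t N =
  ∀ (d : Distribution G) → N ≤ total d →
  ∃ λ (d' : Distribution G) → Reach G d d' × t ≤ d' v

-- N is π_t(G,v): the smallest number such that N pebbles suffice.
-- (If no N is solvable, π_t(G,v) = ∞ and no N satisfies IsPebblingNumber.)
IsPebblingNumber : (G : WGraph) → Vertex G → ℕ → ℕ → Set
IsPebblingNumber G v t N = Solvable G v t N × (∀ M → Solvable G v t M → N ≤ M)

-- π_{st}(G × H,(x,y)) ≤ π_s(G,x) π_t(H,y), with the convention that the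
-- right-hand side is ∞ (inequality trivially true) if either factor is ∞.
-- Since Solvable is upward closed, "π ≤ K" for finite K is exactly "Solvable … K".
ProductBound : (G H : WGraph) → Vertex G → Vertex H → ℕ → ℕ → Set
ProductBound G H x y s t =
  ∀ (N M : ℕ) → IsPebblingNumber G x s N → IsPebblingNumber H y t M →
  Solvable (G ⊠ H) (pair G H x y) (s * t) (N * M)

Statement1 : Set
Statement1 = ∀ (G H : WGraph) (s t : ℕ) → 1 ≤ s → 1 ≤ t →
             (x : Vertex G) (y : Vertex H) → ProductBound G H x y s t

Statement2 : Set
Statement2 = ∀ (G H : WGraph) (x : Vertex G) (y : Vertex H) → ProductBound G H x y 1 1

-- One direction is specialisation. For the other, attach to G a pendant vertex 0 joined
-- to x by an edge of weight s (and likewise to H with t). One pebble on the pendant vertex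
-- costs exactly s pebbles on x, so π(G⁺, 0) = π_s(G, x). The case s = t = 1 then bounds
-- π(G⁺ × H⁺, (0,0)), and collapsing G⁺ × H⁺ back onto G × H, with the pendant corner
-- counting s·t times, turns one pebble on (0,0) into s·t pebbles on (x,y).
--
-- Both "collapsing" steps are instances of one notion, a simulation of A in B: a vertex
-- map with multiplicities under which every edge of A is either collapsed cheaply or
-- mapped onto an edge of B of equal weight. Pushing distributions forward along a
-- simulation turns every sequence of moves in A into moves in B (`push-reach`), and a
-- section of the simulation lets us transfer solvability from A to B (`solvable-transfer`).

module Submission where

open import Defs hiding (sym)
open import Function.Base using (_∘_)
open import Function.Bundles using (_⇔_; mk⇔)
open import Data.Nat using (ℕ; zero; suc; _+_; _*_; _∸_; _≤_; _<_; z≤n; s≤s)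
open import Data.Nat.Properties
open import Data.Fin using (Fin; remQuot)
import Data.Fin as F
import Data.Fin.Properties as FP
open import Data.Bool using (true; false; if_then_else_)
open import Data.Product using (∃; _×_; _,_; proj₁; proj₂)
open import Data.Sum using (_⊎_; inj₁; inj₂)
open import Data.Empty using (⊥-elim)
open import Relation.Nullary using (yes; no; ¬_)
open import Relation.Binary.PropositionalEquality
open import Relation.Binary.Construct.Closure.ReflexiveTransitive using (ε; _◅_; _◅◅_)
open import Algebra.Properties.CommutativeMonoid.Sum +-0-commutativeMonoid using (sum; ∑-distrib-+; ∑-comm)
open import Algebra.Properties.CommutativeSemigroup *-commutativeSemigroup using (x∙yz≈y∙xz)

total≡sum : ∀ {n} (f : Fin n → ℕ) → total f ≡ sum f
total≡sum {zero}  f = refl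
total≡sum {suc n} f = cong (f F.zero +_) (total≡sum (f ∘ F.suc))

total-cong : ∀ {n} {f g : Fin n → ℕ} → (∀ v → f v ≡ g v) → total f ≡ total g
total-cong {zero}  eq = refl
total-cong {suc n} eq = cong₂ _+_ (eq F.zero) (total-cong (eq ∘ F.suc))

total-mono : ∀ {n} {f g : Fin n → ℕ} → (∀ v → f v ≤ g v) → total f ≤ total g
total-mono {zero}  le = z≤n
total-mono {suc n} le = +-mono-≤ (le F.zero) (total-mono (le ∘ F.suc))

total-zero : ∀ n → total {n} (λ _ → 0) ≡ 0
total-zero zero    = refl
total-zero (suc n) = total-zero n

total-+ : ∀ {n} (f g : Fin n → ℕ) → total (λ v → f v + g v) ≡ total f + total g
total-+ f g = begin
  total (λ v → f v + g v) ≡⟨ total≡sum (λ v → f v + g v) ⟩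
  sum (λ v → f v + g v)   ≡⟨ ∑-distrib-+ f g ⟩
  sum f + sum g           ≡⟨ cong₂ _+_ (total≡sum f) (total≡sum g) ⟨
  total f + total g       ∎
  where open ≡-Reasoning

total-swap : ∀ {m n} (h : Fin m → Fin n → ℕ) →
             total (λ u → total (h u)) ≡ total (λ v → total (λ u → h u v))
total-swap h = begin
  total (λ u → total (h u))          ≡⟨ total-cong (λ u → total≡sum (h u)) ⟩
  total (λ u → sum (h u))            ≡⟨ total≡sum (λ u → sum (h u)) ⟩
  sum (λ u → sum (h u))              ≡⟨ ∑-comm h ⟩
  sum (λ v → sum (λ u → h u v))      ≡⟨ total≡sum (λ v → sum (λ u → h u v)) ⟨
  total (λ v → sum (λ u → h u v))    ≡⟨ total-cong (λ v → total≡sum (λ u → h u v)) ⟨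
  total (λ v → total (λ u → h u v))  ∎
  where open ≡-Reasoning

total-delta : ∀ {n} (f : Fin n → ℕ) (k : Fin n) → (∀ v → ¬ v ≡ k → f v ≡ 0) → total f ≡ f k
total-delta {suc n} f F.zero vanish = begin
  f F.zero + total (f ∘ F.suc)   ≡⟨ cong (f F.zero +_) (total-cong (λ v → vanish (F.suc v) (λ ()))) ⟩
  f F.zero + total {n} (λ _ → 0) ≡⟨ cong (f F.zero +_) (total-zero n) ⟩
  f F.zero + 0                   ≡⟨ +-identityʳ _ ⟩
  f F.zero                       ∎
  where open ≡-Reasoning
total-delta {suc n} f (F.suc k) vanish rewrite vanish F.zero (λ ()) =
  total-delta (f ∘ F.suc) k (λ v v≢k → vanish (F.suc v) (v≢k ∘ FP.suc-injective))

term≤total : ∀ {n} (f : Fin n → ℕ) (k : Fin n) → f k ≤ total f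
term≤total f F.zero    = m≤m+n _ _
term≤total f (F.suc k) = ≤-trans (term≤total (f ∘ F.suc) k) (m≤n+m _ _)

_≤ᵖ_ : ∀ {n} → (Fin n → ℕ) → (Fin n → ℕ) → Set
d ≤ᵖ e = ∀ v → d v ≤ e v

_⊕_ : ∀ {n} → (Fin n → ℕ) → (Fin n → ℕ) → (Fin n → ℕ)
(d ⊕ e) v = d v + e v

pt : ∀ {n} → ℕ → Fin n → (Fin n → ℕ)
pt c i v = if v == i then c else 0

pt-self : ∀ {n} c (i : Fin n) → pt c i i ≡ c
pt-self c i with i F.≟ i
... | yes _   = refl
... | no i≢i = ⊥-elim (i≢i refl)

pt-other : ∀ {n} c {i v : Fin n} → ¬ v ≡ i → pt c i v ≡ 0
pt-other c {i} {v} v≢i with v F.≟ i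
... | yes v≡i = ⊥-elim (v≢i v≡i)
... | no _    = refl

pt-zero : ∀ {n} (i v : Fin n) → pt 0 i v ≡ 0
pt-zero i v with v == i
... | true  = refl
... | false = refl

pt-+ : ∀ {n} a b (i v : Fin n) → pt (a + b) i v ≡ pt a i v + pt b i v
pt-+ a b i v with v == i
... | true  = refl
... | false = refl

pt-mono : ∀ {n} {a b} (i v : Fin n) → a ≤ b → pt a i v ≤ pt b i v
pt-mono i v a≤b with v == i
... | true  = a≤b
... | false = z≤n

total-pt : ∀ {n} c (i : Fin n) → total (pt c i) ≡ c
total-pt c i = trans (total-delta (pt c i) i (λ v → pt-other c)) (pt-self c i)

move-source : (G : WGraph) (i j : Vertex G) (d : Distribution G) →
              moveResult G i j d i ≡ d i ∸ weight G i j
move-source G i j d with i F.≟ i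
... | yes _   = refl
... | no i≢i = ⊥-elim (i≢i refl)

move-target : (G : WGraph) (i j : Vertex G) (d : Distribution G) → ¬ j ≡ i →
              moveResult G i j d j ≡ suc (d j)
move-target G i j d j≢i with j F.≟ i
... | yes j≡i = ⊥-elim (j≢i j≡i)
... | no _ with j F.≟ j
...   | yes _   = refl
...   | no j≢j = ⊥-elim (j≢j refl)

edge-distinct : (G : WGraph) {u v : Vertex G} → 0 < weight G u v → ¬ u ≡ v
edge-distinct G {u} pos refl rewrite loopless G u = <-irrefl refl pos

move-mono : (G : WGraph) (i j : Vertex G) {d e : Distribution G} → d ≤ᵖ e →
            moveResult G i j d ≤ᵖ moveResult G i j e
move-mono G i j d≤e v with v == i | v == j
... | true  | _     = ∸-monoˡ-≤ (weight G i j) (d≤e v)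
... | false | true  = s≤s (d≤e v)
... | false | false = d≤e v

reach-mono : (G : WGraph) {d d' e : Distribution G} → d ≤ᵖ e → Reach G d d' →
             ∃ λ e' → Reach G e e' × d' ≤ᵖ e'
reach-mono G d≤e ε = _ , ε , d≤e
reach-mono G {e = e} d≤e (move d i j pos w≤ ◅ r)
  with reach-mono G (move-mono G i j d≤e) r
... | e' , r' , d'≤e' = e' , move e i j pos (≤-trans w≤ (d≤e i)) ◅ r' , d'≤e'

-- `Attainable G d e`: from e one can reach a distribution dominating d.
-- This is the relation in which moves of one graph are simulated in another.
Attainable : (G : WGraph) → Distribution G → Distribution G → Set
Attainable G d e = ∃ λ e' → Reach G e e' × d ≤ᵖ e'

attain-≤ : (G : WGraph) {d e : Distribution G} → d ≤ᵖ e → Attainable G d e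
attain-≤ G d≤e = _ , ε , d≤e

attain-trans : (G : WGraph) {d e f : Distribution G} →
               Attainable G d e → Attainable G e f → Attainable G d f
attain-trans G (e' , r₁ , d≤e') (f' , r₂ , e≤f') with reach-mono G e≤f' r₁
... | f'' , r₃ , e'≤f'' = f'' , r₂ ◅◅ r₃ , (λ v → ≤-trans (d≤e' v) (e'≤f'' v))

move-add : (G : WGraph) (i j : Vertex G) (Z Y : Distribution G) → weight G i j ≤ Y i →
           (Z ⊕ moveResult G i j Y) ≤ᵖ moveResult G i j (Z ⊕ Y)
move-add G i j Z Y w≤ v with v F.≟ i
... | yes refl = ≤-reflexive (sym (+-∸-assoc (Z v) w≤))
... | no _ with v == j
...   | true  = ≤-reflexive (+-suc (Z v) (Y v))
...   | false = ≤-refl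

reach-add : (G : WGraph) (Z : Distribution G) {Y Y' : Distribution G} → Reach G Y Y' →
            Attainable G (Z ⊕ Y') (Z ⊕ Y)
reach-add G Z ε = attain-≤ G (λ _ → ≤-refl)
reach-add G Z (move Y i j pos w≤ ◅ r) = attain-trans G (reach-add G Z r) one-move
  where
  one-move : Attainable G (Z ⊕ moveResult G i j Y) (Z ⊕ Y)
  one-move = _ , move (Z ⊕ Y) i j pos (≤-trans w≤ (m≤n+m (Y i) (Z i))) ◅ ε , move-add G i j Z Y w≤

attain-add : (G : WGraph) (Z : Distribution G) {X Y : Distribution G} →
             Attainable G X Y → Attainable G (Z ⊕ X) (Z ⊕ Y)
attain-add G Z (Y' , r , X≤Y') =
  attain-trans G (attain-≤ G (λ v → +-monoʳ-≤ (Z v) (X≤Y' v))) (reach-add G Z r)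

repeat-move : (G : WGraph) {u v : Vertex G} → 0 < weight G u v → ∀ k (d : Distribution G) →
              k * weight G u v ≤ d u → ∃ λ d' → Reach G d d' × k + d v ≤ d' v
repeat-move G pos zero d _ = d , ε , ≤-refl
repeat-move G {u} {v} pos (suc k) d enough
  with repeat-move G pos k (moveResult G u v d) still-enough
  where
  w = weight G u v
  still-enough : k * w ≤ moveResult G u v d u
  still-enough rewrite move-source G u v d =
    ≤-trans (≤-reflexive (sym (m+n∸m≡n w (k * w)))) (∸-monoˡ-≤ w enough)
... | d' , r , gain = d' , move d u v pos (≤-trans (m≤m+n _ _) enough) ◅ r , gain'
  where
  gain' : suc k + d v ≤ d' v
  gain' rewrite move-target G u v d (edge-distinct G pos ∘ sym) | +-suc k (d v) = gain

edge-attainable : (G : WGraph) {u v : Vertex G} → 0 < weight G u v → ∀ k →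
                  Attainable G (pt k v) (pt (weight G u v * k) u)
edge-attainable G {u} {v} pos k with repeat-move G pos k (pt (weight G u v * k) u) paid
  where
  paid : k * weight G u v ≤ pt (weight G u v * k) u u
  paid rewrite pt-self (weight G u v * k) u = ≤-reflexive (*-comm k (weight G u v))
... | d' , r , gain = d' , r , covers
  where
  covers : pt k v ≤ᵖ d'
  covers x with x F.≟ v
  ... | yes refl = ≤-trans (m≤m+n k _) gain
  ... | no _     = z≤n

drain : ∀ {n} → ℕ → Fin n → (Fin n → ℕ) → (Fin n → ℕ)
drain w i d v = if v == i then d v ∸ w else d v

drain-split : ∀ {n} {w} (i : Fin n) (d : Fin n → ℕ) → w ≤ d i → (drain w i d ⊕ pt w i) ≤ᵖ d
drain-split {w = w} i d w≤ v with v F.≟ i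
... | yes refl = ≤-reflexive (m∸n+n≡m w≤)
... | no _     = ≤-reflexive (+-identityʳ (d v))

move≤drain : (G : WGraph) (i j : Vertex G) (d : Distribution G) →
             moveResult G i j d ≤ᵖ (drain (weight G i j) i d ⊕ pt 1 j)
move≤drain G i j d v with v F.≟ i
... | yes refl = m≤m+n _ _
... | no _ with v F.≟ j
...   | yes refl = ≤-reflexive (+-comm 1 (d v))
...   | no _     = m≤m+n _ _

-- How a vertex map `proj` with multiplicities `mult` may treat an edge ij of weight w:
-- either it collapses the edge, and one pebble on j is worth at most what the w pebbles
-- paid on i are worth; or it maps it onto an edge of the same weight with equal multiplicity.
EdgeImage : (B : WGraph) {V : Set} (proj : V → Vertex B) (mult : V → ℕ) (i j : V) (w : ℕ) → Set
EdgeImage B proj mult i j w =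
    (proj i ≡ proj j × mult j ≤ w * mult i)
  ⊎ (weight B (proj i) (proj j) ≡ w × mult i ≡ mult j)

-- A simulation of A in B: a pebble on v in A stands for `mult v` pebbles on `proj v` in B.
record Simulation (A B : WGraph) : Set where
  field
    proj : Vertex A → Vertex B
    mult : Vertex A → ℕ
    edge : ∀ i j → 0 < weight A i j → EdgeImage B proj mult i j (weight A i j)

-- A section of a simulation: a copy of B inside A carried identically onto B.
record Section {A B : WGraph} (S : Simulation A B) : Set where
  open Simulation S
  field
    lift      : Vertex B → Vertex A
    proj-lift : ∀ u → proj (lift u) ≡ u
    mult-lift : ∀ u → mult (lift u) ≡ 1

module Push {A B : WGraph} (S : Simulation A B) where
  open Simulation S

  push : Distribution A → Distribution B
  push d u = total (λ v → pt (mult v * d v) (proj v) u)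

  push-mono : ∀ {d e} → d ≤ᵖ e → push d ≤ᵖ push e
  push-mono d≤e u = total-mono (λ v → pt-mono (proj v) u (*-monoʳ-≤ (mult v) (d≤e v)))

  push-+ : ∀ d e u → push (d ⊕ e) u ≡ push d u + push e u
  push-+ d e u = trans (total-cong split)
                       (total-+ (λ v → pt (mult v * d v) (proj v) u) (λ v → pt (mult v * e v) (proj v) u))
    where
    split : ∀ v → pt (mult v * (d v + e v)) (proj v) u
                ≡ pt (mult v * d v) (proj v) u + pt (mult v * e v) (proj v) u
    split v = trans (cong (λ c → pt c (proj v) u) (*-distribˡ-+ (mult v) (d v) (e v)))
                    (pt-+ _ _ (proj v) u)

  push-pt : ∀ c i u → push (pt c i) u ≡ pt (mult i * c) (proj i) u
  push-pt c i u = trans (total-delta _ i vanish) (cong (λ c' → pt (mult i * c') (proj i) u) (pt-self c i))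
    where
    vanish : ∀ v → ¬ v ≡ i → pt (mult v * pt c i v) (proj v) u ≡ 0
    vanish v v≢i rewrite pt-other c v≢i | *-zeroʳ (mult v) = pt-zero (proj v) u

  push-lower : ∀ d v → mult v * d v ≤ push d (proj v)
  push-lower d v = subst (_≤ push d (proj v)) (pt-self (mult v * d v) (proj v))
                         (term≤total (λ v' → pt (mult v' * d v') (proj v') (proj v)) v)

  push-total : ∀ d → total (push d) ≡ total (λ v → mult v * d v)
  push-total d = trans (total-swap (λ u v → pt (mult v * d v) (proj v) u))
                       (total-cong (λ v → total-pt (mult v * d v) (proj v)))

  edge-transfer : ∀ i j → 0 < weight A i j →
                  Attainable B (pt (mult j * 1) (proj j)) (pt (mult i * weight A i j) (proj i))
  edge-transfer i j pos with edge i j pos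
  ... | inj₁ (same , cheap) rewrite same =
    attain-≤ B (λ u → pt-mono (proj j) u (begin
      mult j * 1             ≡⟨ *-identityʳ (mult j) ⟩
      mult j                 ≤⟨ cheap ⟩
      weight A i j * mult i  ≡⟨ *-comm (weight A i j) (mult i) ⟩
      mult i * weight A i j  ∎))
    where open ≤-Reasoning
  ... | inj₂ (same-weight , same-mult) =
    attain-trans B (edge-attainable B posB (mult j * 1))
                   (attain-≤ B (λ u → ≤-reflexive (cong (λ c → pt c (proj i) u) cost)))
    where
    posB : 0 < weight B (proj i) (proj j)
    posB rewrite same-weight = pos
    cost : weight B (proj i) (proj j) * (mult j * 1) ≡ mult i * weight A i j
    cost rewrite same-weight | same-mult | *-identityʳ (mult j) = *-comm (weight A i j) (mult j)

  push-step : ∀ {d d₁} → Step A d d₁ → Attainable B (push d₁) (push d)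
  push-step (move d i j pos w≤) =
    attain-trans B (attain-≤ B after)
      (attain-trans B (attain-add B (push rest) (edge-transfer i j pos)) (attain-≤ B before))
    where
    w = weight A i j
    rest = drain w i d
    after : push (moveResult A i j d) ≤ᵖ (push rest ⊕ pt (mult j * 1) (proj j))
    after u = ≤-trans (push-mono (move≤drain A i j d) u)
                      (≤-reflexive (trans (push-+ rest (pt 1 j) u) (cong (push rest u +_) (push-pt 1 j u))))
    before : (push rest ⊕ pt (mult i * w) (proj i)) ≤ᵖ push d
    before u = ≤-trans (≤-reflexive (sym (trans (push-+ rest (pt w i) u) (cong (push rest u +_) (push-pt w i u)))))
                       (push-mono (drain-split i d w≤) u)

  push-reach : ∀ {d d'} → Reach A d d' → Attainable B (push d') (push d)
  push-reach ε         = attain-≤ B (λ _ → ≤-refl)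
  push-reach (s ◅ r) = attain-trans B (push-reach r) (push-step s)

module Transfer {A B : WGraph} {S : Simulation A B} (σ : Section S) where
  open Simulation S
  open Section σ
  open Push S

  raise : Distribution B → Distribution A
  raise e v = pt (e (proj v)) (lift (proj v)) v

  push-raise : ∀ e u → push (raise e) u ≡ e u
  push-raise e u = trans (total-delta _ (lift u) vanish) at-lift
    where
    vanish : ∀ v → ¬ v ≡ lift u → pt (mult v * raise e v) (proj v) u ≡ 0
    vanish v v≢lift with proj v F.≟ u
    ... | yes pv≡u rewrite pt-other (e (proj v)) (λ v≡ → v≢lift (trans v≡ (cong lift pv≡u)))
                         | *-zeroʳ (mult v) = pt-zero (proj v) u
    ... | no pv≢u = pt-other _ (pv≢u ∘ sym)
    at-lift : pt (mult (lift u) * raise e (lift u)) (proj (lift u)) u ≡ e u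
    at-lift rewrite proj-lift u | mult-lift u | pt-self (e u) (lift u) =
      trans (pt-self (1 * e u) u) (*-identityˡ (e u))

  -- `raise e` lives on the copy of B, where all multiplicities are 1.
  mult-raise : ∀ e v → mult v * raise e v ≡ raise e v
  mult-raise e v with v F.≟ lift (proj v)
  ... | yes v≡lift = trans (cong (_* e (proj v)) (trans (cong mult v≡lift) (mult-lift (proj v))))
                           (*-identityˡ (e (proj v)))
  ... | no _       = *-zeroʳ (mult v)

  total-raise : ∀ e → total (raise e) ≡ total e
  total-raise e = begin
    total (raise e)                   ≡⟨ total-cong (mult-raise e) ⟨
    total (λ v → mult v * raise e v)  ≡⟨ push-total (raise e) ⟨
    total (push (raise e))            ≡⟨ total-cong (push-raise e) ⟩
    total e                           ∎
    where open ≡-Reasoning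

  solvable-transfer : ∀ {v N} → Solvable A v 1 N → Solvable B (proj v) (mult v) N
  solvable-transfer {v} sol e N≤ with sol (raise e) (subst (_ ≤_) (sym (total-raise e)) N≤)
  ... | d' , r , one with attain-trans B (push-reach r) (attain-≤ B (≤-reflexive ∘ push-raise e))
  ...   | e' , r' , covered = e' , r' , (begin
    mult v            ≡⟨ *-identityʳ (mult v) ⟨
    mult v * 1        ≤⟨ *-monoʳ-≤ (mult v) one ⟩
    mult v * d' v     ≤⟨ push-lower d' v ⟩
    push d' (proj v)  ≤⟨ covered (proj v) ⟩
    e' (proj v)       ∎)
    where open ≤-Reasoning

prodW-same-first : (G H : WGraph) (x : Vertex G) (y y' : Vertex H) → prodW G H x y x y' ≡ weight H y y'
prodW-same-first G H x y y' with x F.≟ x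
... | yes _   = refl
... | no x≢x = ⊥-elim (x≢x refl)

prodW-same-second : (G H : WGraph) {x x' : Vertex G} (y : Vertex H) → ¬ x ≡ x' →
                    prodW G H x y x' y ≡ weight G x x'
prodW-same-second G H {x} {x'} y x≢x' with x F.≟ x' | y F.≟ y
... | yes x≡x' | _       = ⊥-elim (x≢x' x≡x')
... | no _     | yes _   = refl
... | no _     | no y≢y = ⊥-elim (y≢y refl)

⊠-weight : (G H : WGraph) (x x' : Vertex G) (y y' : Vertex H) →
           weight (G ⊠ H) (pair G H x y) (pair G H x' y') ≡ prodW G H x y x' y'
⊠-weight G H x x' y y' =
  cong₂ (λ p p' → prodW G H (proj₁ p) (proj₂ p) (proj₁ p') (proj₂ p'))
        (FP.remQuot-combine x y) (FP.remQuot-combine x' y')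

module Product {A₁ B₁ A₂ B₂ : WGraph} (S : Simulation A₁ B₁) (T : Simulation A₂ B₂) where
  module S = Simulation S
  module T = Simulation T

  projᵖ : Vertex A₁ × Vertex A₂ → Vertex (B₁ ⊠ B₂)
  projᵖ (a , b) = pair B₁ B₂ (S.proj a) (T.proj b)

  multᵖ : Vertex A₁ × Vertex A₂ → ℕ
  multᵖ (a , b) = S.mult a * T.mult b

  edge-vertical : ∀ a b b' → 0 < weight A₂ b b' →
                  EdgeImage (B₁ ⊠ B₂) projᵖ multᵖ (a , b) (a , b') (weight A₂ b b')
  edge-vertical a b b' pos with T.edge b b' pos
  ... | inj₁ (same , cheap) = inj₁ (cong (pair B₁ B₂ (S.proj a)) same , (begin
    S.mult a * T.mult b'                  ≤⟨ *-monoʳ-≤ (S.mult a) cheap ⟩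
    S.mult a * (weight A₂ b b' * T.mult b) ≡⟨ x∙yz≈y∙xz (S.mult a) (weight A₂ b b') (T.mult b) ⟩
    weight A₂ b b' * (S.mult a * T.mult b) ∎))
    where open ≤-Reasoning
  ... | inj₂ (same-weight , same-mult) = inj₂
    ( trans (⊠-weight B₁ B₂ (S.proj a) (S.proj a) (T.proj b) (T.proj b'))
            (trans (prodW-same-first B₁ B₂ (S.proj a) (T.proj b) (T.proj b')) same-weight)
    , cong (S.mult a *_) same-mult )

  edge-horizontal : ∀ a a' b → 0 < weight A₁ a a' →
                    EdgeImage (B₁ ⊠ B₂) projᵖ multᵖ (a , b) (a' , b) (weight A₁ a a')
  edge-horizontal a a' b pos with S.edge a a' pos
  ... | inj₁ (same , cheap) = inj₁ (cong (λ p → pair B₁ B₂ p (T.proj b)) same , (begin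
    S.mult a' * T.mult b                    ≤⟨ *-monoˡ-≤ (T.mult b) cheap ⟩
    weight A₁ a a' * S.mult a * T.mult b    ≡⟨ *-assoc (weight A₁ a a') (S.mult a) (T.mult b) ⟩
    weight A₁ a a' * (S.mult a * T.mult b)  ∎))
    where open ≤-Reasoning
  ... | inj₂ (same-weight , same-mult) = inj₂
    ( trans (⊠-weight B₁ B₂ (S.proj a) (S.proj a') (T.proj b) (T.proj b))
            (trans (prodW-same-second B₁ B₂ (T.proj b) distinct) same-weight)
    , cong (_* T.mult b) same-mult )
    where
    distinct : ¬ S.proj a ≡ S.proj a'
    distinct = edge-distinct B₁ (subst (0 <_) (sym same-weight) pos)

  -- Edges of A₁ × A₂ change exactly one coordinate, so S and T cover all of them.
  edgeᵖ : ∀ a b a' b' → 0 < prodW A₁ A₂ a b a' b' →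
          EdgeImage (B₁ ⊠ B₂) projᵖ multᵖ (a , b) (a' , b') (prodW A₁ A₂ a b a' b')
  edgeᵖ a b a' b' pos with a F.≟ a'
  ... | yes refl = edge-vertical a b b' pos
  ... | no _ with b F.≟ b'
  ...   | yes refl = edge-horizontal a a' b pos
  ...   | no _     = ⊥-elim (<-irrefl refl pos)

  simulation : Simulation (A₁ ⊠ A₂) (B₁ ⊠ B₂)
  simulation = record
    { proj = projᵖ ∘ remQuot (size A₂)
    ; mult = multᵖ ∘ remQuot (size A₂)
    ; edge = λ i j → edgeᵖ _ _ _ _
    }

  section : Section S → Section T → Section simulation
  section σ τ = record
    { lift      = liftᵖ
    ; proj-lift = proj-liftᵖ
    ; mult-lift = mult-liftᵖ
    }
    where
    module σ = Section σ
    module τ = Section τ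
    liftᵖ : Vertex (B₁ ⊠ B₂) → Vertex (A₁ ⊠ A₂)
    liftᵖ u = pair A₁ A₂ (σ.lift (proj₁ (remQuot {size B₁} (size B₂) u)))
                         (τ.lift (proj₂ (remQuot {size B₁} (size B₂) u)))
    proj-liftᵖ : ∀ u → projᵖ (remQuot (size A₂) (liftᵖ u)) ≡ u
    proj-liftᵖ u = begin
      projᵖ (remQuot (size A₂) (liftᵖ u))
        ≡⟨ cong projᵖ (FP.remQuot-combine (σ.lift a) (τ.lift b)) ⟩
      pair B₁ B₂ (S.proj (σ.lift a)) (T.proj (τ.lift b))
        ≡⟨ cong₂ (pair B₁ B₂) (σ.proj-lift a) (τ.proj-lift b) ⟩
      pair B₁ B₂ a b
        ≡⟨ FP.combine-remQuot {size B₁} (size B₂) u ⟩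
      u ∎
      where
      open ≡-Reasoning
      a = proj₁ (remQuot {size B₁} (size B₂) u)
      b = proj₂ (remQuot {size B₁} (size B₂) u)
    mult-liftᵖ : ∀ u → multᵖ (remQuot (size A₂) (liftᵖ u)) ≡ 1
    mult-liftᵖ u = trans (cong multᵖ (FP.remQuot-combine (σ.lift a) (τ.lift b)))
                         (cong₂ _*_ (σ.mult-lift a) (τ.mult-lift b))
      where
      a = proj₁ (remQuot {size B₁} (size B₂) u)
      b = proj₂ (remQuot {size B₁} (size B₂) u)

pendantW : (G : WGraph) → Vertex G → ℕ → Fin (suc (size G)) → Fin (suc (size G)) → ℕ
pendantW G x s F.zero    F.zero    = 0
pendantW G x s F.zero    (F.suc j) = if j == x then s else 0
pendantW G x s (F.suc i) F.zero    = if i == x then s else 0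
pendantW G x s (F.suc i) (F.suc j) = weight G i j

pendant : (G : WGraph) → Vertex G → ℕ → WGraph
pendant G x s = record
  { size     = suc (size G)
  ; weight   = pendantW G x s
  ; sym      = symmetric
  ; loopless = no-loop
  }
  where
  symmetric : ∀ i j → pendantW G x s i j ≡ pendantW G x s j i
  symmetric F.zero    F.zero    = refl
  symmetric F.zero    (F.suc j) = refl
  symmetric (F.suc i) F.zero    = refl
  symmetric (F.suc i) (F.suc j) = WGraph.sym G i j
  no-loop : ∀ i → pendantW G x s i i ≡ 0
  no-loop F.zero    = refl
  no-loop (F.suc i) = loopless G i

module Pendant (G : WGraph) (x : Vertex G) (s : ℕ) where
  G⁺ = pendant G x s

  pendant-edge : weight G⁺ (F.suc x) F.zero ≡ s
  pendant-edge with x F.≟ x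
  ... | yes _   = refl
  ... | no x≢x = ⊥-elim (x≢x refl)

  inclusion : Simulation G G⁺
  inclusion = record { proj = F.suc ; mult = λ _ → 1 ; edge = λ _ _ _ → inj₂ (refl , refl) }

  module Inclusion = Push inclusion

  push-inclusion : ∀ d → Inclusion.push (d ∘ F.suc) ≤ᵖ d
  push-inclusion d F.zero = ≤-trans (≤-reflexive (trans (total-cong vanish) (total-zero (size G)))) z≤n
    where
    vanish : ∀ v → pt (1 * d (F.suc v)) (F.suc v) F.zero ≡ 0
    vanish v = pt-other (1 * d (F.suc v)) {F.suc v} {F.zero} (λ ())
  push-inclusion d (F.suc p) = ≤-reflexive (begin
    Inclusion.push (d ∘ F.suc) (F.suc p)  ≡⟨ total-delta _ p vanish ⟩
    pt (1 * d (F.suc p)) (F.suc p) (F.suc p) ≡⟨ pt-self _ (F.suc p) ⟩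
    1 * d (F.suc p)                         ≡⟨ *-identityˡ _ ⟩
    d (F.suc p)                             ∎)
    where
    open ≡-Reasoning
    vanish : ∀ v → ¬ v ≡ p → pt (1 * d (F.suc v)) (F.suc v) (F.suc p) ≡ 0
    vanish v v≢p = pt-other _ (λ eq → v≢p (sym (FP.suc-injective eq)))

  collapse-proj : Vertex G⁺ → Vertex G
  collapse-proj F.zero    = x
  collapse-proj (F.suc i) = i

  collapse-mult : Vertex G⁺ → ℕ
  collapse-mult F.zero    = s
  collapse-mult (F.suc _) = 1

  -- The pendant edge is collapsed: a pebble arriving at either end is worth no more than
  -- the s pebbles paid at the other end (this needs 1 ≤ s). All other edges are kept.
  collapse-edge : 1 ≤ s → ∀ i j → 0 < weight G⁺ i j →
                  EdgeImage G collapse-proj collapse-mult i j (weight G⁺ i j)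
  collapse-edge 1≤s F.zero F.zero ()
  collapse-edge 1≤s F.zero (F.suc j) pos with j F.≟ x
  ... | yes refl = inj₁ (refl , *-mono-≤ 1≤s 1≤s)
  ... | no _     = ⊥-elim (<-irrefl refl pos)
  collapse-edge 1≤s (F.suc i) F.zero pos with i F.≟ x
  ... | yes refl = inj₁ (refl , ≤-reflexive (sym (*-identityʳ s)))
  ... | no _     = ⊥-elim (<-irrefl refl pos)
  collapse-edge 1≤s (F.suc i) (F.suc j) pos = inj₂ (refl , refl)

  collapse : 1 ≤ s → Simulation G⁺ G
  collapse 1≤s = record { proj = collapse-proj ; mult = collapse-mult ; edge = collapse-edge 1≤s }

  collapse-section : (1≤s : 1 ≤ s) → Section (collapse 1≤s)
  collapse-section 1≤s = record { lift = F.suc ; proj-lift = λ _ → refl ; mult-lift = λ _ → refl }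

  final-move : 1 ≤ s → ∀ d → s ≤ d (F.suc x) → ∃ λ d' → Reach G⁺ d d' × 1 ≤ d' F.zero
  final-move 1≤s d enough =
    moveResult G⁺ (F.suc x) F.zero d ,
    move d (F.suc x) F.zero (subst (0 <_) (sym pendant-edge) 1≤s)
                            (subst (_≤ d (F.suc x)) (sym pendant-edge) enough) ◅ ε ,
    subst (1 ≤_) (sym (move-target G⁺ (F.suc x) F.zero d (λ ()))) (s≤s z≤n)

  -- Either the pendant vertex is already covered, or G alone can bring s pebbles to x.
  pendant-solvable : 1 ≤ s → ∀ {N} → Solvable G x s N → Solvable G⁺ F.zero 1 N
  pendant-solvable 1≤s sol d N≤ with d F.zero in d₀
  ... | suc _ = d , ε , ≤-trans (s≤s z≤n) (≤-reflexive (sym d₀))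
  ... | zero with sol (d ∘ F.suc) N≤
  ...   | e , r , s≤e with attain-trans G⁺ (Inclusion.push-reach r) (attain-≤ G⁺ (push-inclusion d))
  ...     | e' , r' , covered with final-move 1≤s e' on-x
    where
    on-x : s ≤ e' (F.suc x)
    on-x = ≤-trans s≤e (≤-trans (≤-reflexive (sym (*-identityˡ (e x))))
                                (≤-trans (Inclusion.push-lower e x) (covered (F.suc x))))
  ...       | e'' , r'' , one = e'' , r' ◅◅ r'' , one

  -- π_s(G, x) = N implies π(G⁺, 0) = N: solvability as above, minimality by collapsing.
  pendant-number : 1 ≤ s → ∀ {N} → IsPebblingNumber G x s N → IsPebblingNumber G⁺ F.zero 1 N
  pendant-number 1≤s (solvable , least) =
    pendant-solvable 1≤s solvable ,
    λ M sol⁺ → least M (Transfer.solvable-transfer (collapse-section 1≤s) sol⁺)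

theorem4p6 : Statement1 ⇔ Statement2
theorem4p6 = mk⇔ specialise generalise
  where
  specialise : Statement1 → Statement2
  specialise st₁ G H x y = st₁ G H 1 1 ≤-refl ≤-refl x y
  generalise : Statement2 → Statement1
  generalise st₂ G H s t 1≤s 1≤t x y N M πG πH =
    Transfer.solvable-transfer (Product.section (PG.collapse 1≤s) (PH.collapse 1≤t)
                                                (PG.collapse-section 1≤s) (PH.collapse-section 1≤t))
      (st₂ PG.G⁺ PH.G⁺ F.zero F.zero N M (PG.pendant-number 1≤s πG) (PH.pendant-number 1≤t πH))
    where
    module PG = Pendant G x s
    module PH = Pendant H y t
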